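{- Let $G=(G'_\ell,A'_\ell,B'_\ell)\circ(G'_{\ell-1},A'_{\ell-1},B'_{\ell-1})\circ\cdots\circ(G'_1,A'_1,B'_1)\circ G'_0$ be the compact canonical decomposition of $G$. Let $S\subseteq V(G)$ and let $S_i=S\cap V(G'_i)$. Then $S$ is a fixing set of $G$ if and only if $S_i$ is a fixing set of $G'_i$ for $i=0,1,\dots,\ell$. Consequently, $\mathrm{Fix}(G)=\sum_{i=0}^{\ell}\mathrm{Fix}(G'_i)$.
   Context: All graphs are finite and simple. A subset $S\subseteq V(G)$ is a fixing set of $G$ if the only automorphism of $G$ fixing every element of $S$ is the identity; $\mathrm{Fix}(G)$ is the minimum size of a fixing set. A graph $G$ is split if $V(G)$ can be partitioned into sets $A,B$ (either possibly empty) with $A$ a clique and $B$ an independent set; $(A,B)$ is a $KS$-partition and $(G,A,B)$ the split graph with this partition. For a split graph $(G,A,B)$ and a graph $H$ with disjoint vertex sets, $(G,A,B)\circ H$ has vertex set $V(G)\cup V(H)$ and edge set $E(G)\cup E(H)\cup\{uv:u\in A,v\in V(H)\}$; if $H=(H,A',B')$ is split the result is regarded as split with $KS$-partition $(A\cup A',B\cup B')$. Composition is associative. A graph is decomposable if it is isomorphic to $(G,A,B)\circ H$ for a split graph $(G,A,B)$ and a graph $H$ each with at least one vertex; otherwise indecomposable. (Tyshkevich) Every graph $G$ has a canonical decomposition $G=(G_k,A_k,B_k)\circ\cdots\circ(G_1,A_1,B_1)\circ G_0$ with every $G_i$ indecomposable, unique up to isomorphism of the components. A single-vertex component $(G_i,A_i,B_i)$,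 $i\ge1$, has type $K_1$ if its vertex lies in $A_i$ and type $S_1$ if it lies in $B_i$; if $G_0$ and $G_1$ both have a single vertex, $G_0$ is assigned the type of $G_1$. The compact canonical decomposition is obtained from the canonical decomposition by replacing each maximal run of consecutive single-vertex components of the same type, say $m$ of them, by one component: the complete graph on those $m$ vertices with $KS$-partition (all vertices, $\emptyset$) for type $K_1$, or the edgeless graph on those $m$ vertices with $KS$-partition ($\emptyset$, all vertices) for type $S_1$. -}

module Defs where

open import Data.Nat using (ℕ; zero; suc; _+_; _≤_)
open import Data.Bool using (Bool; true; false; _∧_; not; if_then_else_)
open import Data.Bool.Properties using (∧-comm)
open import Data.Fin using (Fin; zero; suc; splitAt; _≟_)
open import Data.Fin.Subset using (Subset; _∈_; ∣_∣)
open import Data.Fin.Permutation using (Permutation′; _⟨$⟩ʳ_)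
open import Data.Vec using (take; drop)
open import Data.List using (List; []; _∷_; _++_; [_])
open import Data.List.Relation.Unary.All using (All)
open import Data.Maybe using (Maybe; just; nothing)
open import Data.Product using (Σ; ∃; _×_; _,_; proj₁; proj₂)
open import Data.Sum using (_⊎_; inj₁; inj₂)
open import Function.Bundles using (_↔_; Inverse; _⇔_)
open import Relation.Nullary using (¬_; yes; no)
open import Relation.Nullary.Decidable using (⌊_⌋)
open import Relation.Binary.PropositionalEquality using (_≡_; _≢_; refl; sym; trans)

record Graph : Set where
  field
    n      : ℕ
    adj    : Fin n → Fin n → Bool
    adj-sym : ∀ i j → adj i j ≡ adj j i
    irrefl : ∀ i → adj i i ≡ false
open Graph public

-- Split graph (G, A, B): inA v ≡ true means v ∈ A, false means v ∈ B.
record SplitGraph : Set where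
  field
    graph  : Graph
    inA    : Fin (n graph) → Bool
    clique : ∀ i j → i ≢ j → inA i ≡ true → inA j ≡ true → adj graph i j ≡ true
    indep  : ∀ i j → inA i ≡ false → inA j ≡ false → adj graph i j ≡ false
open SplitGraph public

IsAutomorphism : (G : Graph) → Permutation′ (n G) → Set
IsAutomorphism G π = ∀ i j → adj G (π ⟨$⟩ʳ i) (π ⟨$⟩ʳ j) ≡ adj G i j

IsFixingSet : (G : Graph) → Subset (n G) → Set
IsFixingSet G S =
  ∀ (π : Permutation′ (n G)) → IsAutomorphism G π →
  (∀ v → v ∈ S → π ⟨$⟩ʳ v ≡ v) → ∀ v → π ⟨$⟩ʳ v ≡ v

FixNumber : Graph → ℕ → Set
FixNumber G k =
  (Σ (Subset (n G)) λ S → IsFixingSet G S × ∣ S ∣ ≡ k)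
  × (∀ S → IsFixingSet G S → k ≤ ∣ S ∣)

Isomorphic : Graph → Graph → Set
Isomorphic G H =
  Σ (Fin (n G) ↔ Fin (n H)) λ f →
    ∀ i j → adj H (Inverse.to f i) (Inverse.to f j) ≡ adj G i j

module _ {m k : ℕ} (a : Fin m → Fin m → Bool) (b : Fin k → Fin k → Bool)
         (p : Fin m → Bool) where
  cadj : Fin m ⊎ Fin k → Fin m ⊎ Fin k → Bool
  cadj (inj₁ i) (inj₁ j) = a i j
  cadj (inj₂ i) (inj₂ j) = b i j
  cadj (inj₁ i) (inj₂ j) = p i
  cadj (inj₂ i) (inj₁ j) = p j

  cadj-sym : (∀ i j → a i j ≡ a j i) → (∀ i j → b i j ≡ b j i) →
             ∀ u v → cadj u v ≡ cadj v u
  cadj-sym sa sb (inj₁ i) (inj₁ j) = sa i j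
  cadj-sym sa sb (inj₂ i) (inj₂ j) = sb i j
  cadj-sym sa sb (inj₁ i) (inj₂ j) = refl
  cadj-sym sa sb (inj₂ i) (inj₁ j) = refl

  cadj-irr : (∀ i → a i i ≡ false) → (∀ i → b i i ≡ false) →
             ∀ u → cadj u u ≡ false
  cadj-irr ia ib (inj₁ i) = ia i
  cadj-irr ia ib (inj₂ i) = ib i

-- (G, A, B) ∘ H : vertices of G come first (Fin (n G + n H)), then those of H;
-- every vertex of A is joined to every vertex of H.
_∘ₛ_ : SplitGraph → Graph → Graph
C ∘ₛ H = record
  { n      = n (graph C) + n H
  ; adj    = λ x y → cadj (adj (graph C)) (adj H) (inA C)
                          (splitAt (n (graph C)) x) (splitAt (n (graph C)) y)
  ; adj-sym = λ x y → cadj-sym (adj (graph C)) (adj H) (inA C)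
                          (adj-sym (graph C)) (adj-sym H)
                          (splitAt (n (graph C)) x) (splitAt (n (graph C)) y)
  ; irrefl = λ x → cadj-irr (adj (graph C)) (adj H) (inA C)
                          (irrefl (graph C)) (irrefl H) (splitAt (n (graph C)) x)
  }

Decomposable : Graph → Set
Decomposable G =
  Σ SplitGraph λ C → Σ Graph λ H →
    1 ≤ n (graph C) × 1 ≤ n H × Isomorphic G (C ∘ₛ H)

Indecomposable : Graph → Set
Indecomposable G = ¬ Decomposable G

-- Decompositions  G_k ∘ ⋯ ∘ G_1 ∘ G_0 : the list holds [G_k , … , G_1]
-- (outermost first), together with the final graph G_0.

compose : List SplitGraph → Graph → Graph
compose []       G0 = G0
compose (C ∷ Cs) G0 = C ∘ₛ compose Cs G0

IsCanonical : List SplitGraph → Graph → Set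
IsCanonical Cs G0 =
  All (λ C → 1 ≤ n (graph C) × Indecomposable (graph C)) Cs
  × 1 ≤ n G0 × Indecomposable G0

-- type of a single-vertex split component: just true = K₁, just false = S₁
single : (m : ℕ) → (Fin m → Bool) → Maybe Bool
single (suc zero) f = just (f zero)
single _          f = nothing

stype : SplitGraph → Maybe Bool
stype C = single (n (graph C)) (inA C)

isOne : ℕ → Bool
isOne (suc zero) = true
isOne _          = false

neq : {m : ℕ} → Fin m → Fin m → Bool
neq i j = not ⌊ i ≟ j ⌋

neq-sym : {m : ℕ} (i j : Fin m) → neq i j ≡ neq j i
neq-sym i j with i ≟ j | j ≟ i
... | yes _ | yes _ = refl
... | no _  | no _  = refl
... | yes p | no q  = Relation.Nullary.contradiction (sym p) q
... | no p  | yes q = Relation.Nullary.contradiction (sym q) p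

neq-irr : {m : ℕ} (i : Fin m) → neq i i ≡ false
neq-irr i with i ≟ i
... | yes _ = refl
... | no p  = Relation.Nullary.contradiction refl p

neq-true : {m : ℕ} (i j : Fin m) → i ≢ j → neq i j ≡ true
neq-true i j p with i ≟ j
... | yes q = Relation.Nullary.contradiction q p
... | no _  = refl

runGraph : Bool → ℕ → Graph
runGraph t m = record
  { n = m
  ; adj = λ i j → t ∧ neq i j
  ; adj-sym = λ i j → Relation.Binary.PropositionalEquality.cong (t ∧_) (neq-sym i j)
  ; irrefl = λ i → trans (Relation.Binary.PropositionalEquality.cong (t ∧_) (neq-irr i)) (∧-comm t false)
  }

runComp : Bool → ℕ → SplitGraph
runComp t m = record
  { graph  = runGraph t m
  ; inA    = λ _ → t
  ; clique = λ { i j p refl _ → neq-true i j p }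
  ; indep  = λ { i j refl _ → refl }
  }

flush : Maybe (Bool × ℕ) → List SplitGraph
flush nothing        = []
flush (just (t , m)) = [ runComp t m ]

eqB : Bool → Bool → Bool
eqB true  true  = true
eqB false false = true
eqB _     _     = false

-- The accumulator holds the current run of single-vertex components
-- (its type and its length).
compactGo : Maybe (Bool × ℕ) → List SplitGraph → Graph → List SplitGraph × Graph
compactGo acc [] G0 with isOne (n G0) | acc
... | true  | just (t , m) = [] , runGraph t (suc m)   -- G_0 takes the type of G_1
... | _     | _            = flush acc , G0
compactGo acc (C ∷ Cs) G0 with stype C | acc
... | nothing | _ = let r = compactGo nothing Cs G0 in flush acc ++ C ∷ proj₁ r , proj₂ r
... | just t | nothing = compactGo (just (t , 1)) Cs G0
... | just t | just (t' , m) =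
  if eqB t t'
  then compactGo (just (t , suc m)) Cs G0
  else (let r = compactGo (just (t , 1)) Cs G0 in flush acc ++ proj₁ r , proj₂ r)

compact : List SplitGraph → Graph → List SplitGraph × Graph
compact = compactGo nothing

-- Componentwise conditions. For G = C ∘ H, S ∩ V(C) = take (n C) S and
-- S ∩ V(H) = drop (n C) S.

AllFixing : (Cs : List SplitGraph) (G0 : Graph) → Subset (n (compose Cs G0)) → Set
AllFixing []       G0 S = IsFixingSet G0 S
AllFixing (C ∷ Cs) G0 S =
  IsFixingSet (graph C) (take (n (graph C)) S) × AllFixing Cs G0 (drop (n (graph C)) S)

FixSum : List SplitGraph → Graph → ℕ → Set
FixSum []       G0 k = FixNumber G0 k
FixSum (C ∷ Cs) G0 k =
  Σ ℕ λ k₁ → Σ ℕ λ k₂ → k ≡ k₁ + k₂ × FixNumber (graph C) k₁ × FixSum Cs G0 k₂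

{-# OPTIONS --safe #-}
-- Call a composition (C, A, B) ∘ H automorphism-splitting if every automorphism of C ∘ H maps
-- V(C) onto itself and every automorphism of C preserves A. The automorphisms of such a
-- composition are exactly the pairs (ρ, τ) of an A-preserving automorphism of C and an
-- automorphism of H, so S fixes C ∘ H iff S ∩ V(C) fixes C and S ∩ V(H) fixes H, and minimum
-- fixing sets add up. Every step of the compact canonical decomposition is automorphism-splitting.
-- For an indecomposable component C with at least two vertices, the vertices of C that an
-- automorphism keeps inside V(C) would otherwise decompose C, and the KS-partition of C is unique.
-- A run of type K₁ (S₁) consists exactly of the dominating (isolated) vertices of the graph it
-- starts, because what follows it, an indecomposable component or a run of the other type, has
-- no such vertex.
module Submission where

open import Defs
open import Data.Nat using (ℕ; suc; _+_; _≤_; z≤n; s≤s)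
open import Data.Nat.Properties using (≤-trans; m≤m+n; +-cancelʳ-≤; +-cancelˡ-≤; +-mono-≤; module ≤-Reasoning)
open import Data.Bool using (Bool; true; false; not; _∧_)
import Data.Bool as Bool
open import Data.Bool.Properties using (¬-not; not-¬; ∧-identityʳ)
open import Data.Empty using (⊥; ⊥-elim)
open import Data.Unit using (⊤; tt)
open import Data.Fin using (Fin; zero; suc; splitAt; join; _↑ˡ_; _↑ʳ_; punchIn; fromℕ<; _≟_)
open import Data.Fin.Properties
  using (splitAt-↑ˡ; splitAt-↑ʳ; splitAt⁻¹-↑ˡ; splitAt⁻¹-↑ʳ; splitAt-join; ↑ˡ-injective; ↑ʳ-injective; +↔⊎;
         punchInᵢ≢i; any?)
open import Data.Fin.Subset using (Subset; _∈_; _∉_; ∣_∣; ∁; Nonempty; ⁅_⁆)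
open import Data.Fin.Subset.Properties
  using (x∈p⇒∣p-x∣<∣p∣; nonempty?; x∈⁅x⁆; x∈⁅y⁆⇒x≡y; x≢y⇒x∉⁅y⁆; x∉⁅y⁆⇒x≢y;
         x∈∁p⇒x∉p; x∉∁p⇒x∈p; x∉p⇒x∈∁p; x∈p⇒x∉∁p)
open import Data.Fin.Permutation using (Permutation′; _⟨$⟩ʳ_; _⟨$⟩ˡ_; inverseˡ; inverseʳ; permutation; flip; id)
open import Data.List using (List; []; _∷_)
import Data.List as List
open import Data.List.Relation.Unary.All using (_∷_)
open import Data.Maybe using (Maybe; just; nothing)
open import Data.Product using (Σ; ∃; ∃₂; _×_; _,_; proj₁; proj₂)
open import Data.Product.Function.NonDependent.Propositional using (_×-⇔_)
open import Data.Sum using (_⊎_; inj₁; inj₂; [_,_]′)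
import Data.Sum as Sum
open import Data.Sum.Function.Propositional using (_⊎-↔_)
open import Data.Vec using ([]; _∷_; here; there; lookup; tabulate; take; drop; _++_)
open import Data.Vec.Properties
  using ([]=⇒lookup; lookup⇒[]=; lookup∘tabulate; lookup-++ˡ; lookup-++ʳ; take++drop≡id; ++-injective)
open import Function using (_∘_; const)
open import Function.Bundles using (_↔_; _⇔_; mk↔ₛ′; mk⇔; Equivalence; Injection)
open import Function.Construct.Composition using (_↔-∘_; _⇔-∘_)
open import Function.Construct.Identity using (⇔-id)
open import Function.Construct.Symmetry using (↔-sym)
open import Function.Properties.Inverse using (↔⇒↣)
open import Relation.Nullary using (¬_; yes; no)
open import Relation.Nullary.Decidable using (¬?; _×-dec_; decidable-stable)
open import Relation.Binary.PropositionalEquality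

private variable
  a b m : ℕ
  t : Bool

-- Partitions of finite index sets

embed : (p : Subset m) → Fin ∣ p ∣ → Fin m
embed (true  ∷ p) zero    = zero
embed (true  ∷ p) (suc i) = suc (embed p i)
embed (false ∷ p) i       = suc (embed p i)

embed-∈ : (p : Subset m) (i : Fin ∣ p ∣) → embed p i ∈ p
embed-∈ (true  ∷ p) zero    = here
embed-∈ (true  ∷ p) (suc i) = there (embed-∈ p i)
embed-∈ (false ∷ p) i       = there (embed-∈ p i)

locate : (p : Subset m) → Fin m → Fin ∣ p ∣ ⊎ Fin ∣ ∁ p ∣
locate (true  ∷ p) zero    = inj₁ zero
locate (false ∷ p) zero    = inj₂ zero
locate (true  ∷ p) (suc x) = Sum.map₁ suc (locate p x)
locate (false ∷ p) (suc x) = Sum.map₂ suc (locate p x)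

unlocate : (p : Subset m) → Fin ∣ p ∣ ⊎ Fin ∣ ∁ p ∣ → Fin m
unlocate p = [ embed p , embed (∁ p) ]′

unlocate-locate : (p : Subset m) (x : Fin m) → unlocate p (locate p x) ≡ x
unlocate-locate (true  ∷ p) zero    = refl
unlocate-locate (false ∷ p) zero    = refl
unlocate-locate (true  ∷ p) (suc x) with locate p x | unlocate-locate p x
... | inj₁ _ | eq = cong suc eq
... | inj₂ _ | eq = cong suc eq
unlocate-locate (false ∷ p) (suc x) with locate p x | unlocate-locate p x
... | inj₁ _ | eq = cong suc eq
... | inj₂ _ | eq = cong suc eq

locate-embed : (p : Subset m) (i : Fin ∣ p ∣) → locate p (embed p i) ≡ inj₁ i
locate-embed (true  ∷ p) zero    = refl
locate-embed (true  ∷ p) (suc i) = cong (Sum.map₁ suc) (locate-embed p i)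
locate-embed (false ∷ p) i       = cong (Sum.map₂ suc) (locate-embed p i)

locate-embed∁ : (p : Subset m) (j : Fin ∣ ∁ p ∣) → locate p (embed (∁ p) j) ≡ inj₂ j
locate-embed∁ (true  ∷ p) j       = cong (Sum.map₁ suc) (locate-embed∁ p j)
locate-embed∁ (false ∷ p) zero    = refl
locate-embed∁ (false ∷ p) (suc j) = cong (Sum.map₂ suc) (locate-embed∁ p j)

locate-unlocate : (p : Subset m) (u : Fin ∣ p ∣ ⊎ Fin ∣ ∁ p ∣) → locate p (unlocate p u) ≡ u
locate-unlocate p (inj₁ i) = locate-embed p i
locate-unlocate p (inj₂ j) = locate-embed∁ p j

partition : (p : Subset m) → Fin m ↔ (Fin ∣ p ∣ ⊎ Fin ∣ ∁ p ∣)
partition p = mk↔ₛ′ (locate p) (unlocate p) (locate-unlocate p) (unlocate-locate p)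

embed-injective : (p : Subset m) {i j : Fin ∣ p ∣} → embed p i ≡ embed p j → i ≡ j
embed-injective p {i} {j} eq with trans (sym (locate-embed p i)) (trans (cong (locate p) eq) (locate-embed p j))
... | refl = refl

∈⇒1≤∣p∣ : {p : Subset m} {x : Fin m} → x ∈ p → 1 ≤ ∣ p ∣
∈⇒1≤∣p∣ x∈p = ≤-trans (s≤s z≤n) (x∈p⇒∣p-x∣<∣p∣ x∈p)

∣p++q∣≡∣p∣+∣q∣ : (p : Subset a) (q : Subset b) → ∣ p ++ q ∣ ≡ ∣ p ∣ + ∣ q ∣
∣p++q∣≡∣p∣+∣q∣ []          q = refl
∣p++q∣≡∣p∣+∣q∣ (true  ∷ p) q = cong suc (∣p++q∣≡∣p∣+∣q∣ p q)
∣p++q∣≡∣p∣+∣q∣ (false ∷ p) q = ∣p++q∣≡∣p∣+∣q∣ p q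

∣p∣≡∣take∣+∣drop∣ : (a : ℕ) (p : Subset (a + b)) → ∣ p ∣ ≡ ∣ take a p ∣ + ∣ drop a p ∣
∣p∣≡∣take∣+∣drop∣ a p = trans (cong ∣_∣ (sym (take++drop≡id a p))) (∣p++q∣≡∣p∣+∣q∣ (take a p) (drop a p))

take-++ : (p : Subset a) (q : Subset b) → take a (p ++ q) ≡ p
take-++ {a} p q = proj₁ (++-injective (take a (p ++ q)) p (take++drop≡id a (p ++ q)))

drop-++ : (p : Subset a) (q : Subset b) → drop a (p ++ q) ≡ q
drop-++ {a} p q = proj₂ (++-injective (take a (p ++ q)) p (take++drop≡id a (p ++ q)))

∈-take : (a : ℕ) (p : Subset (a + b)) (i : Fin a) → i ∈ take a p ⇔ i ↑ˡ b ∈ p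
∈-take a p i = mk⇔ (λ i∈ → lookup⇒[]= _ p (trans lookup-↑ˡ ([]=⇒lookup i∈)))
                   (λ i∈ → lookup⇒[]= i _ (trans (sym lookup-↑ˡ) ([]=⇒lookup i∈)))
  where
  lookup-↑ˡ : lookup p (i ↑ˡ _) ≡ lookup (take a p) i
  lookup-↑ˡ = trans (cong (λ q → lookup q (i ↑ˡ _)) (sym (take++drop≡id a p))) (lookup-++ˡ (take a p) _ i)

∈-drop : (a : ℕ) (p : Subset (a + b)) (j : Fin b) → j ∈ drop a p ⇔ a ↑ʳ j ∈ p
∈-drop a p j = mk⇔ (λ j∈ → lookup⇒[]= _ p (trans lookup-↑ʳ ([]=⇒lookup j∈)))
                   (λ j∈ → lookup⇒[]= j _ (trans (sym lookup-↑ʳ) ([]=⇒lookup j∈)))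
  where
  lookup-↑ʳ : lookup p (a ↑ʳ j) ≡ lookup (drop a p) j
  lookup-↑ʳ = trans (cong (λ q → lookup q (a ↑ʳ j)) (sym (take++drop≡id a p))) (lookup-++ʳ (take a p) _ j)

leftPart : {A B : Set} → (Fin m → A ⊎ B) → Subset m
leftPart f = tabulate ([ const true , const false ]′ ∘ f)

∈-leftPart⁺ : {A B : Set} (f : Fin m → A ⊎ B) {i : Fin m} {a : A} → f i ≡ inj₁ a → i ∈ leftPart f
∈-leftPart⁺ f {i} eq = lookup⇒[]= i _ (trans (lookup∘tabulate _ i) (cong [ const true , const false ]′ eq))

∈-leftPart⁻ : {A B : Set} (f : Fin m → A ⊎ B) {i : Fin m} → i ∈ leftPart f → ∃ λ a → f i ≡ inj₁ a
∈-leftPart⁻ f {i} i∈ with f i | trans (sym (lookup∘tabulate _ i)) ([]=⇒lookup i∈)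
... | inj₁ a | _ = a , refl

∉-leftPart⁺ : {A B : Set} (f : Fin m → A ⊎ B) {i : Fin m} {b : B} → f i ≡ inj₂ b → i ∉ leftPart f
∉-leftPart⁺ f eq i∈ with ∈-leftPart⁻ f i∈
... | a , eq' with () ← trans (sym eq) eq'

∉-leftPart⁻ : {A B : Set} (f : Fin m → A ⊎ B) {i : Fin m} → i ∉ leftPart f → ∃ λ b → f i ≡ inj₂ b
∉-leftPart⁻ f {i} i∉ with f i in eq
... | inj₁ a = ⊥-elim (i∉ (∈-leftPart⁺ f eq))
... | inj₂ b = b , refl

data Block (a : ℕ) {b : ℕ} : Fin (a + b) → Set where
  left  : (i : Fin a) → Block a (i ↑ˡ b)
  right : (j : Fin b) → Block a (a ↑ʳ j)

block : (a : ℕ) {b : ℕ} (x : Fin (a + b)) → Block a x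
block a x with splitAt a x in eq
... | inj₁ i = subst (Block a) (splitAt⁻¹-↑ˡ eq) (left i)
... | inj₂ j = subst (Block a) (splitAt⁻¹-↑ʳ eq) (right j)

↑ˡ≢↑ʳ : {i : Fin a} {j : Fin b} → i ↑ˡ b ≢ a ↑ʳ j
↑ˡ≢↑ʳ {a} {b} {i} {j} eq with trans (sym (splitAt-↑ˡ a i b)) (trans (cong (splitAt a) eq) (splitAt-↑ʳ a b j))
... | ()

_⊕_ : Permutation′ a → Permutation′ b → Permutation′ (a + b)
ρ ⊕ τ = ↔-sym +↔⊎ ↔-∘ ((ρ ⊎-↔ τ) ↔-∘ +↔⊎)

⊕-↑ˡ : (ρ : Permutation′ a) (τ : Permutation′ b) (i : Fin a) → (ρ ⊕ τ) ⟨$⟩ʳ (i ↑ˡ b) ≡ (ρ ⟨$⟩ʳ i) ↑ˡ b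
⊕-↑ˡ {a} {b} ρ τ i = cong (join a b ∘ Sum.map (ρ ⟨$⟩ʳ_) (τ ⟨$⟩ʳ_)) (splitAt-↑ˡ a i b)

⊕-↑ʳ : (ρ : Permutation′ a) (τ : Permutation′ b) (j : Fin b) → (ρ ⊕ τ) ⟨$⟩ʳ (a ↑ʳ j) ≡ a ↑ʳ (τ ⟨$⟩ʳ j)
⊕-↑ʳ {a} {b} ρ τ j = cong (join a b ∘ Sum.map (ρ ⟨$⟩ʳ_) (τ ⟨$⟩ʳ_)) (splitAt-↑ʳ a b j)

LeftInvariant : (a : ℕ) {b : ℕ} → Permutation′ (a + b) → Set
LeftInvariant a {b} π = ∀ i → ∃ λ i' → π ⟨$⟩ʳ (i ↑ˡ b) ≡ i' ↑ˡ b

RightInvariant : (a : ℕ) {b : ℕ} → Permutation′ (a + b) → Set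
RightInvariant a π = ∀ j → ∃ λ j' → π ⟨$⟩ʳ (a ↑ʳ j) ≡ a ↑ʳ j'

leftInvariant⁻¹⇒rightInvariant : (π : Permutation′ (a + b)) → LeftInvariant a (flip π) → RightInvariant a π
leftInvariant⁻¹⇒rightInvariant {a} π inv j with π ⟨$⟩ʳ (a ↑ʳ j) | inverseˡ π {a ↑ʳ j}
... | x | π⁻¹x≡ with block a x
...   | right j' = j' , refl
...   | left i   = ⊥-elim (↑ˡ≢↑ʳ (trans (sym (proj₂ (inv i))) π⁻¹x≡))

restrict : {a : ℕ} (e : Fin a → Fin m) → (∀ {i j} → e i ≡ e j → i ≡ j) → (π : Permutation′ m) →
           (∀ i → ∃ λ i' → π ⟨$⟩ʳ e i ≡ e i') → (∀ i → ∃ λ i' → π ⟨$⟩ˡ e i ≡ e i') →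
           Σ (Permutation′ a) λ ρ → ∀ i → π ⟨$⟩ʳ e i ≡ e (ρ ⟨$⟩ʳ i)
restrict e e-injective π forth back =
  permutation (proj₁ ∘ forth) (proj₁ ∘ back) (inverse π forth back) (inverse (flip π) back forth) ,
  proj₂ ∘ forth
  where
  inverse : (σ : Permutation′ _) (f : ∀ i → ∃ λ i' → σ ⟨$⟩ʳ e i ≡ e i') (g : ∀ i → ∃ λ i' → σ ⟨$⟩ˡ e i ≡ e i') →
            ∀ i → proj₁ (f (proj₁ (g i))) ≡ i
  inverse σ f g i = e-injective (begin
    e (proj₁ (f (proj₁ (g i))))  ≡⟨ sym (proj₂ (f (proj₁ (g i)))) ⟩
    σ ⟨$⟩ʳ e (proj₁ (g i))       ≡⟨ cong (σ ⟨$⟩ʳ_) (sym (proj₂ (g i))) ⟩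
    σ ⟨$⟩ʳ (σ ⟨$⟩ˡ e i)          ≡⟨ inverseʳ σ ⟩
    e i                          ∎)
    where open ≡-Reasoning

⊕-split : (π : Permutation′ (a + b)) → LeftInvariant a π → LeftInvariant a (flip π) →
          ∃₂ λ ρ τ → ∀ x → π ⟨$⟩ʳ x ≡ (ρ ⊕ τ) ⟨$⟩ʳ x
⊕-split {a} {b} π πˡ π⁻¹ˡ = ρ , τ , agree
  where
  restrictˡ : Σ (Permutation′ a) λ ρ → ∀ i → π ⟨$⟩ʳ (i ↑ˡ b) ≡ (ρ ⟨$⟩ʳ i) ↑ˡ b
  restrictˡ = restrict (_↑ˡ b) (↑ˡ-injective b _ _) π πˡ π⁻¹ˡ
  restrictʳ : Σ (Permutation′ b) λ τ → ∀ j → π ⟨$⟩ʳ (a ↑ʳ j) ≡ a ↑ʳ (τ ⟨$⟩ʳ j)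
  restrictʳ = restrict (a ↑ʳ_) (↑ʳ-injective a _ _) π
                (leftInvariant⁻¹⇒rightInvariant π π⁻¹ˡ) (leftInvariant⁻¹⇒rightInvariant (flip π) πˡ)
  ρ : Permutation′ a
  ρ = proj₁ restrictˡ
  τ : Permutation′ b
  τ = proj₁ restrictʳ
  agree : ∀ x → π ⟨$⟩ʳ x ≡ (ρ ⊕ τ) ⟨$⟩ʳ x
  agree x with block a x
  ... | left i  = trans (proj₂ restrictˡ i) (sym (⊕-↑ˡ ρ τ i))
  ... | right j = trans (proj₂ restrictʳ j) (sym (⊕-↑ʳ ρ τ j))

-- Universal vertices, KS-partitions and a decomposition criterion

⟨$⟩ʳ-injective : (π : Permutation′ m) {i j : Fin m} → π ⟨$⟩ʳ i ≡ π ⟨$⟩ʳ j → i ≡ j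
⟨$⟩ʳ-injective π = Injection.injective (↔⇒↣ π)

another : 2 ≤ m → (x : Fin m) → ∃ λ w → w ≢ x
another (s≤s (s≤s _)) x = punchIn x zero , punchInᵢ≢i x zero

module _ (G : Graph) where

  automorphism-flip : (π : Permutation′ (n G)) → IsAutomorphism G π → IsAutomorphism G (flip π)
  automorphism-flip π aut i j =
    trans (sym (aut (π ⟨$⟩ˡ i) (π ⟨$⟩ˡ j))) (cong₂ (adj G) (inverseʳ π) (inverseʳ π))

  HasNeighbourhood : Fin (n G) → (Fin (n G) → Bool) → Set
  HasNeighbourhood x f = ∀ w → w ≢ x → adj G x w ≡ f w

  Universal : Bool → Fin (n G) → Set
  Universal t x = HasNeighbourhood x (const t)

  NoUniversal : Bool → Set
  NoUniversal t = ∀ x → ¬ Universal t x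

  universal-automorphism : (π : Permutation′ (n G)) → IsAutomorphism G π →
                           ∀ {x} → Universal t x → Universal t (π ⟨$⟩ʳ x)
  universal-automorphism π aut {x} u w w≢πx =
    trans (cong (adj G (π ⟨$⟩ʳ x)) (sym (inverseʳ π)))
          (trans (aut x (π ⟨$⟩ˡ w)) (u (π ⟨$⟩ˡ w) λ eq → w≢πx (trans (sym (inverseʳ π)) (cong (π ⟨$⟩ʳ_) eq))))

  IsKSPartition : (Fin (n G) → Bool) → Set
  IsKSPartition p = (∀ i j → i ≢ j → p i ≡ true → p j ≡ true → adj G i j ≡ true)
                  × (∀ i j → p i ≡ false → p j ≡ false → adj G i j ≡ false)

  isKSPartition-automorphism : (π : Permutation′ (n G)) → IsAutomorphism G π →
                               ∀ {p} → IsKSPartition p → IsKSPartition (p ∘ (π ⟨$⟩ʳ_))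
  isKSPartition-automorphism π aut (p-clique , p-indep) =
    (λ i j i≢j pi pj → trans (sym (aut i j)) (p-clique _ _ (i≢j ∘ ⟨$⟩ʳ-injective π) pi pj)) ,
    (λ i j pi pj → trans (sym (aut i j)) (p-indep _ _ pi pj))

  induced : Subset (n G) → Graph
  induced Z = record
    { n       = ∣ Z ∣
    ; adj     = λ i j → adj G (embed Z i) (embed Z j)
    ; adj-sym = λ i j → adj-sym G (embed Z i) (embed Z j)
    ; irrefl  = λ i → irrefl G (embed Z i)
    }

  module _ (Z : Subset (n G)) (q : Fin (n G) → Bool)
    (q-clique : ∀ i j → i ≢ j → i ∈ Z → j ∈ Z → q i ≡ true → q j ≡ true → adj G i j ≡ true)
    (q-indep  : ∀ i j → i ∈ Z → j ∈ Z → q i ≡ false → q j ≡ false → adj G i j ≡ false)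
    (q-join   : ∀ i j → i ∈ Z → j ∉ Z → adj G i j ≡ q i) where

    inducedSplit : SplitGraph
    inducedSplit = record
      { graph  = induced Z
      ; inA    = q ∘ embed Z
      ; clique = λ i j i≢j → q-clique _ _ (i≢j ∘ embed-injective Z) (embed-∈ Z i) (embed-∈ Z j)
      ; indep  = λ i j → q-indep _ _ (embed-∈ Z i) (embed-∈ Z j)
      }

    adj-unlocate : ∀ u w → cadj (adj (induced Z)) (adj (induced (∁ Z))) (q ∘ embed Z) u w
                           ≡ adj G (unlocate Z u) (unlocate Z w)
    adj-unlocate (inj₁ i) (inj₁ j) = refl
    adj-unlocate (inj₂ i) (inj₂ j) = refl
    adj-unlocate (inj₁ i) (inj₂ j) = sym (q-join _ _ (embed-∈ Z i) (x∈∁p⇒x∉p (embed-∈ (∁ Z) j)))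
    adj-unlocate (inj₂ i) (inj₁ j) =
      sym (trans (adj-sym G _ _) (q-join _ _ (embed-∈ Z j) (x∈∁p⇒x∉p (embed-∈ (∁ Z) i))))

    isomorphic-inducedSplit : Isomorphic G (inducedSplit ∘ₛ induced (∁ Z))
    isomorphic-inducedSplit = ↔-sym +↔⊎ ↔-∘ partition Z , preserves
      where
      open ≡-Reasoning
      preserves : ∀ x y → adj (inducedSplit ∘ₛ induced (∁ Z)) (join _ _ (locate Z x)) (join _ _ (locate Z y))
                          ≡ adj G x y
      preserves x y = begin
        cadj _ _ _ (splitAt ∣ Z ∣ (join _ _ (locate Z x))) (splitAt ∣ Z ∣ (join _ _ (locate Z y)))
          ≡⟨ cong₂ (cadj _ _ _) (splitAt-join _ _ (locate Z x)) (splitAt-join _ _ (locate Z y)) ⟩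
        cadj _ _ _ (locate Z x) (locate Z y)
          ≡⟨ adj-unlocate (locate Z x) (locate Z y) ⟩
        adj G (unlocate Z (locate Z x)) (unlocate Z (locate Z y))
          ≡⟨ cong₂ (adj G) (unlocate-locate Z x) (unlocate-locate Z y) ⟩
        adj G x y ∎

    decomposable-along : Nonempty Z → Nonempty (∁ Z) → Decomposable G
    decomposable-along (_ , x∈Z) (_ , y∈∁Z) =
      inducedSplit , induced (∁ Z) , ∈⇒1≤∣p∣ x∈Z , ∈⇒1≤∣p∣ y∈∁Z , isomorphic-inducedSplit

  module _ (two : 2 ≤ n G) where

    universal⇒decomposable : ∀ {x} → Universal t x → Decomposable G
    universal⇒decomposable {t} {x} u =
      decomposable-along ⁅ x ⁆ (const t) x-clique x-indep x-join
        (x , x∈⁅x⁆ x) (w , x∉p⇒x∈∁p (x≢y⇒x∉⁅y⁆ w≢x))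
      where
      w : Fin (n G)
      w = proj₁ (another two x)
      w≢x : w ≢ x
      w≢x = proj₂ (another two x)
      x-clique : ∀ i j → i ≢ j → i ∈ ⁅ x ⁆ → j ∈ ⁅ x ⁆ → t ≡ true → t ≡ true → adj G i j ≡ true
      x-clique i j i≢j i∈ j∈ _ _ = ⊥-elim (i≢j (trans (x∈⁅y⁆⇒x≡y x i∈) (sym (x∈⁅y⁆⇒x≡y x j∈))))
      x-indep : ∀ i j → i ∈ ⁅ x ⁆ → j ∈ ⁅ x ⁆ → t ≡ false → t ≡ false → adj G i j ≡ false
      x-indep i j i∈ j∈ _ _ rewrite x∈⁅y⁆⇒x≡y x i∈ | x∈⁅y⁆⇒x≡y x j∈ = irrefl G x
      x-join : ∀ i j → i ∈ ⁅ x ⁆ → j ∉ ⁅ x ⁆ → adj G i j ≡ t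
      x-join i j i∈ j∉ rewrite x∈⁅y⁆⇒x≡y x i∈ = u j (x∉⁅y⁆⇒x≢y j∉)

    -- G = (G - x, A ∖ x, B ∖ x) ∘ {x}
    cliqueNeighbourhood⇒decomposable : ∀ {p} → IsKSPartition p → ∀ {x} → HasNeighbourhood x p → Decomposable G
    cliqueNeighbourhood⇒decomposable {p} (p-clique , p-indep) {x} h =
      decomposable-along (∁ ⁅ x ⁆) p (λ i j i≢j _ _ → p-clique i j i≢j) (λ i j _ _ → p-indep i j) x-join
        (w , x∉p⇒x∈∁p (x≢y⇒x∉⁅y⁆ w≢x)) (x , x∉p⇒x∈∁p (x∈p⇒x∉∁p (x∈⁅x⁆ x)))
      where
      w : Fin (n G)
      w = proj₁ (another two x)
      w≢x : w ≢ x
      w≢x = proj₂ (another two x)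
      x-join : ∀ i j → i ∈ ∁ ⁅ x ⁆ → j ∉ ∁ ⁅ x ⁆ → adj G i j ≡ p i
      x-join i j i∈ j∉ rewrite x∈⁅y⁆⇒x≡y x (x∉∁p⇒x∈p j∉) =
        trans (adj-sym G i x) (h i (x∉⁅y⁆⇒x≢y (x∈∁p⇒x∉p i∈)))

    module _ (indecomposable : Indecomposable G) where

      -- Let p and q give the partitions (A, B) and (A', B'), and x ∈ B ∩ A'. Unless the
      -- neighbourhood of x is A, some w ∈ A ∩ B' has neighbourhood A ∖ w.
      ksPartition-B∩A'-empty : ∀ {p q} → IsKSPartition p → IsKSPartition q →
                               ∀ {x} → p x ≡ false → q x ≡ true → ⊥
      ksPartition-B∩A'-empty {p} {q} ksp@(p-clique , p-indep) (q-clique , q-indep) {x} px qx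
        with any? (λ w → ¬? (w ≟ x) ×-dec ¬? (adj G x w Bool.≟ p w))
      ... | no ∄w = indecomposable (cliqueNeighbourhood⇒decomposable ksp λ w w≢x →
                      decidable-stable (adj G x w Bool.≟ p w) λ ≢pw → ∄w (w , w≢x , ≢pw))
      ... | yes (w , w≢x , ≢pw) with p w in pw | q w in qw
      ...   | false | _     = ≢pw (p-indep x w px pw)
      ...   | true  | true  = ≢pw (q-clique x w (w≢x ∘ sym) qx qw)
      ...   | true  | false = indecomposable (cliqueNeighbourhood⇒decomposable ksp hw)
        where
        hw : HasNeighbourhood w p
        hw z z≢w with z ≟ x
        ... | yes refl = trans (adj-sym G w x) (trans (¬-not ≢pw) (sym px))
        ... | no z≢x with p z in pz | q z in qz
        ...   | true  | _     = p-clique w z (z≢w ∘ sym) pw pz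
        ...   | false | false = q-indep w z qw qz
        ...   | false | true with () ← trans (sym (q-clique z x z≢x qz qx)) (p-indep z x pz px)

      ksPartition-unique : ∀ {p q} → IsKSPartition p → IsKSPartition q → ∀ x → p x ≡ q x
      ksPartition-unique {p} {q} ksp ksq x with p x in px | q x in qx
      ... | true  | true  = refl
      ... | false | false = refl
      ... | false | true  = ⊥-elim (ksPartition-B∩A'-empty ksp ksq px qx)
      ... | true  | false = ⊥-elim (ksPartition-B∩A'-empty ksq ksp qx px)

      indecomposable⇒noUniversal : NoUniversal t
      indecomposable⇒noUniversal x u = indecomposable (universal⇒decomposable u)

universal-constantPartition : (C : SplitGraph) → (∀ i → inA C i ≡ t) → ∀ x → Universal (graph C) t x
universal-constantPartition {true}  C constant x w w≢x = clique C x w (w≢x ∘ sym) (constant x) (constant w)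
universal-constantPartition {false} C constant x w w≢x = indep C x w (constant x) (constant w)

constantPartition⇒decomposable : (C : SplitGraph) → 2 ≤ n (graph C) → (∀ i → inA C i ≡ t) →
                                 Decomposable (graph C)
constantPartition⇒decomposable C two constant =
  universal⇒decomposable (graph C) two (universal-constantPartition C constant (fromℕ< (≤-trans (s≤s z≤n) two)))

-- Automorphisms and fixing sets of a composition

Fixes : Permutation′ m → Subset m → Set
Fixes π S = ∀ v → v ∈ S → π ⟨$⟩ʳ v ≡ v

module _ {k l : ℕ} (ρ : Permutation′ k) (τ : Permutation′ l) where

  ⊕-fixes-↑ˡ : ∀ i → (ρ ⊕ τ) ⟨$⟩ʳ (i ↑ˡ l) ≡ i ↑ˡ l ⇔ ρ ⟨$⟩ʳ i ≡ i
  ⊕-fixes-↑ˡ i = mk⇔ (λ fixed → ↑ˡ-injective l _ _ (trans (sym (⊕-↑ˡ ρ τ i)) fixed))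
                     (λ fixed → trans (⊕-↑ˡ ρ τ i) (cong (_↑ˡ l) fixed))

  ⊕-fixes-↑ʳ : ∀ j → (ρ ⊕ τ) ⟨$⟩ʳ (k ↑ʳ j) ≡ k ↑ʳ j ⇔ τ ⟨$⟩ʳ j ≡ j
  ⊕-fixes-↑ʳ j = mk⇔ (λ fixed → ↑ʳ-injective k _ _ (trans (sym (⊕-↑ʳ ρ τ j)) fixed))
                     (λ fixed → trans (⊕-↑ʳ ρ τ j) (cong (k ↑ʳ_) fixed))

  ⊕-fixes : (S : Subset (k + l)) → Fixes (ρ ⊕ τ) S ⇔ (Fixes ρ (take k S) × Fixes τ (drop k S))
  ⊕-fixes S = mk⇔
    (λ fixes → (λ i i∈ → Equivalence.to (⊕-fixes-↑ˡ i) (fixes _ (Equivalence.to (∈-take k S i) i∈))) ,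
               (λ j j∈ → Equivalence.to (⊕-fixes-↑ʳ j) (fixes _ (Equivalence.to (∈-drop k S j) j∈))))
    (λ (fixesˡ , fixesʳ) → fixes fixesˡ fixesʳ)
    where
    fixes : Fixes ρ (take k S) → Fixes τ (drop k S) → Fixes (ρ ⊕ τ) S
    fixes fixesˡ fixesʳ x x∈ with block k x
    ... | left i  = Equivalence.from (⊕-fixes-↑ˡ i) (fixesˡ i (Equivalence.from (∈-take k S i) x∈))
    ... | right j = Equivalence.from (⊕-fixes-↑ʳ j) (fixesʳ j (Equivalence.from (∈-drop k S j) x∈))

  ⊕-identity : (∀ i → ρ ⟨$⟩ʳ i ≡ i) → (∀ j → τ ⟨$⟩ʳ j ≡ j) → ∀ x → (ρ ⊕ τ) ⟨$⟩ʳ x ≡ x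
  ⊕-identity ρ-id τ-id x with block k x
  ... | left i  = Equivalence.from (⊕-fixes-↑ˡ i) (ρ-id i)
  ... | right j = Equivalence.from (⊕-fixes-↑ʳ j) (τ-id j)

module _ (C : SplitGraph) (H : Graph) where

  private
    k l : ℕ
    k = n (graph C)
    l = n H
    G : Graph
    G = C ∘ₛ H
    cadjG : Fin k ⊎ Fin l → Fin k ⊎ Fin l → Bool
    cadjG = cadj (adj (graph C)) (adj H) (inA C)

  adj-↑ˡ-↑ˡ : ∀ i j → adj G (i ↑ˡ l) (j ↑ˡ l) ≡ adj (graph C) i j
  adj-↑ˡ-↑ˡ i j = cong₂ cadjG (splitAt-↑ˡ k i l) (splitAt-↑ˡ k j l)

  adj-↑ʳ-↑ʳ : ∀ i j → adj G (k ↑ʳ i) (k ↑ʳ j) ≡ adj H i j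
  adj-↑ʳ-↑ʳ i j = cong₂ cadjG (splitAt-↑ʳ k l i) (splitAt-↑ʳ k l j)

  adj-↑ˡ-↑ʳ : ∀ i j → adj G (i ↑ˡ l) (k ↑ʳ j) ≡ inA C i
  adj-↑ˡ-↑ʳ i j = cong₂ cadjG (splitAt-↑ˡ k i l) (splitAt-↑ʳ k l j)

  adj-↑ʳ-↑ˡ : ∀ j i → adj G (k ↑ʳ j) (i ↑ˡ l) ≡ inA C i
  adj-↑ʳ-↑ˡ j i = cong₂ cadjG (splitAt-↑ʳ k l j) (splitAt-↑ˡ k i l)

  PreservesPartition : Permutation′ k → Set
  PreservesPartition ρ = ∀ i → inA C (ρ ⟨$⟩ʳ i) ≡ inA C i

  ⊕-automorphism : ∀ {ρ τ} → IsAutomorphism (graph C) ρ → PreservesPartition ρ → IsAutomorphism H τ →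
                   IsAutomorphism G (ρ ⊕ τ)
  ⊕-automorphism {ρ} {τ} autρ preserves autτ x y =
    trans (cong₂ cadjG (splitAt-join k l (ρ⊎τ (splitAt k x))) (splitAt-join k l (ρ⊎τ (splitAt k y))))
          (onSum (splitAt k x) (splitAt k y))
    where
    ρ⊎τ : Fin k ⊎ Fin l → Fin k ⊎ Fin l
    ρ⊎τ = Sum.map (ρ ⟨$⟩ʳ_) (τ ⟨$⟩ʳ_)
    onSum : ∀ u w → cadjG (ρ⊎τ u) (ρ⊎τ w) ≡ cadjG u w
    onSum (inj₁ i) (inj₁ j) = autρ i j
    onSum (inj₁ i) (inj₂ j) = preserves i
    onSum (inj₂ i) (inj₁ j) = preserves j
    onSum (inj₂ i) (inj₂ j) = autτ i j

  ⊕-automorphism⁻ˡ : ∀ {ρ τ} → IsAutomorphism G (ρ ⊕ τ) → IsAutomorphism (graph C) ρ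
  ⊕-automorphism⁻ˡ {ρ} {τ} aut i j = begin
    adj (graph C) (ρ ⟨$⟩ʳ i) (ρ ⟨$⟩ʳ j)            ≡⟨ sym (adj-↑ˡ-↑ˡ _ _) ⟩
    adj G ((ρ ⟨$⟩ʳ i) ↑ˡ l) ((ρ ⟨$⟩ʳ j) ↑ˡ l)       ≡⟨ sym (cong₂ (adj G) (⊕-↑ˡ ρ τ i) (⊕-↑ˡ ρ τ j)) ⟩
    adj G ((ρ ⊕ τ) ⟨$⟩ʳ (i ↑ˡ l)) ((ρ ⊕ τ) ⟨$⟩ʳ (j ↑ˡ l)) ≡⟨ aut _ _ ⟩
    adj G (i ↑ˡ l) (j ↑ˡ l)                       ≡⟨ adj-↑ˡ-↑ˡ i j ⟩
    adj (graph C) i j                             ∎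
    where open ≡-Reasoning

  ⊕-automorphism⁻ʳ : ∀ {ρ τ} → IsAutomorphism G (ρ ⊕ τ) → IsAutomorphism H τ
  ⊕-automorphism⁻ʳ {ρ} {τ} aut i j = begin
    adj H (τ ⟨$⟩ʳ i) (τ ⟨$⟩ʳ j)                    ≡⟨ sym (adj-↑ʳ-↑ʳ _ _) ⟩
    adj G (k ↑ʳ (τ ⟨$⟩ʳ i)) (k ↑ʳ (τ ⟨$⟩ʳ j))       ≡⟨ sym (cong₂ (adj G) (⊕-↑ʳ ρ τ i) (⊕-↑ʳ ρ τ j)) ⟩
    adj G ((ρ ⊕ τ) ⟨$⟩ʳ (k ↑ʳ i)) ((ρ ⊕ τ) ⟨$⟩ʳ (k ↑ʳ j)) ≡⟨ aut _ _ ⟩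
    adj G (k ↑ʳ i) (k ↑ʳ j)                       ≡⟨ adj-↑ʳ-↑ʳ i j ⟩
    adj H i j                                     ∎
    where open ≡-Reasoning

  SplitsAutomorphisms : Set
  SplitsAutomorphisms = (∀ π → IsAutomorphism G π → LeftInvariant k π)
                      × (∀ ρ → IsAutomorphism (graph C) ρ → PreservesPartition ρ)

  fixingSet-∘ₛ : SplitsAutomorphisms → ∀ S →
                 IsFixingSet G S ⇔ (IsFixingSet (graph C) (take k S) × IsFixingSet H (drop k S))
  fixingSet-∘ₛ (leftInvariant , preservesPartition) S = mk⇔ to from
    where
    to : IsFixingSet G S → IsFixingSet (graph C) (take k S) × IsFixingSet H (drop k S)
    to fixing = fixingˡ , fixingʳ
      where
      fixingˡ : IsFixingSet (graph C) (take k S)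
      fixingˡ ρ autρ ρ-fixes i = Equivalence.to (⊕-fixes-↑ˡ ρ id i) (fixing (ρ ⊕ id) aut⊕ fixes⊕ (i ↑ˡ l))
        where
        aut⊕ : IsAutomorphism G (ρ ⊕ id)
        aut⊕ = ⊕-automorphism {ρ} {id} autρ (preservesPartition ρ autρ) (λ _ _ → refl)
        fixes⊕ : Fixes (ρ ⊕ id) S
        fixes⊕ = Equivalence.from (⊕-fixes ρ id S) (ρ-fixes , λ _ _ → refl)
      fixingʳ : IsFixingSet H (drop k S)
      fixingʳ τ autτ τ-fixes j = Equivalence.to (⊕-fixes-↑ʳ id τ j) (fixing (id ⊕ τ) aut⊕ fixes⊕ (k ↑ʳ j))
        where
        aut⊕ : IsAutomorphism G (id ⊕ τ)
        aut⊕ = ⊕-automorphism {id} {τ} (λ _ _ → refl) (λ _ → refl) autτ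
        fixes⊕ : Fixes (id ⊕ τ) S
        fixes⊕ = Equivalence.from (⊕-fixes id τ S) ((λ _ _ → refl) , τ-fixes)
    from : IsFixingSet (graph C) (take k S) × IsFixingSet H (drop k S) → IsFixingSet G S
    from (fixingˡ , fixingʳ) π aut π-fixes
      with ⊕-split π (leftInvariant π aut) (leftInvariant (flip π) (automorphism-flip G π aut))
    ... | ρ , τ , agree = λ x → trans (agree x) (⊕-identity ρ τ ρ-id τ-id x)
      where
      aut⊕ : IsAutomorphism G (ρ ⊕ τ)
      aut⊕ x y = trans (sym (cong₂ (adj G) (agree x) (agree y))) (aut x y)
      fixes⊕ : Fixes ρ (take k S) × Fixes τ (drop k S)
      fixes⊕ = Equivalence.to (⊕-fixes ρ τ S) λ x x∈ → trans (sym (agree x)) (π-fixes x x∈)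
      ρ-id : ∀ i → ρ ⟨$⟩ʳ i ≡ i
      ρ-id = fixingˡ ρ (⊕-automorphism⁻ˡ {ρ} {τ} aut⊕) (proj₁ fixes⊕)
      τ-id : ∀ j → τ ⟨$⟩ʳ j ≡ j
      τ-id = fixingʳ τ (⊕-automorphism⁻ʳ {ρ} {τ} aut⊕) (proj₂ fixes⊕)

  universal-↑ˡ : ∀ {i} → Universal G t (i ↑ˡ l) → Universal (graph C) t i
  universal-↑ˡ {i = i} u w w≢i = trans (sym (adj-↑ˡ-↑ˡ i w)) (u (w ↑ˡ l) (w≢i ∘ ↑ˡ-injective l w i))

  universal-↑ʳ : ∀ {j} → Universal G t (k ↑ʳ j) → Universal H t j
  universal-↑ʳ {j = j} u w w≢j = trans (sym (adj-↑ʳ-↑ʳ j w)) (u (k ↑ʳ w) (w≢j ∘ ↑ʳ-injective k w j))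

  universal-↑ʳ⇒constantPartition : ∀ {j} → Universal G t (k ↑ʳ j) → ∀ i → inA C i ≡ t
  universal-↑ʳ⇒constantPartition {j = j} u i = trans (sym (adj-↑ʳ-↑ˡ j i)) (u (i ↑ˡ l) ↑ˡ≢↑ʳ)

  universalBlock⇒leftInvariant : (∀ i → Universal G t (i ↑ˡ l)) → (∀ j → ¬ Universal G t (k ↑ʳ j)) →
                                 ∀ σ → IsAutomorphism G σ → LeftInvariant k σ
  universalBlock⇒leftInvariant universalˡ ¬universalʳ σ aut i
    with σ ⟨$⟩ʳ (i ↑ˡ l) | universal-automorphism G σ aut (universalˡ i)
  ... | x | universal-x with block k x
  ...   | left i'  = i' , refl
  ...   | right j' = ⊥-elim (¬universalʳ j' universal-x)

  module _ (two : 2 ≤ k) (indecomposable : Indecomposable (graph C)) where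

    noUniversal-indecomposable∘ₛ : NoUniversal G t
    noUniversal-indecomposable∘ₛ x u with block k x
    ... | left i  = indecomposable⇒noUniversal (graph C) two indecomposable i (universal-↑ˡ u)
    ... | right j = indecomposable (constantPartition⇒decomposable C two (universal-↑ʳ⇒constantPartition u))

    module _ (σ : Permutation′ (k + l)) (aut : IsAutomorphism G σ) where

      image : Fin k → Fin k ⊎ Fin l
      image i = splitAt k (σ ⟨$⟩ʳ (i ↑ˡ l))

      adj-image : ∀ i j → adj (graph C) i j ≡ cadjG (image i) (image j)
      adj-image i j = trans (sym (adj-↑ˡ-↑ˡ i j)) (sym (aut (i ↑ˡ l) (j ↑ˡ l)))

      image-injective : ∀ {i j} → image i ≡ image j → i ≡ j
      image-injective {i} {j} eq =
        ↑ˡ-injective l i j (⟨$⟩ʳ-injective σ (Injection.injective (↔⇒↣ +↔⊎) eq))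

      imageSide : Fin k → Bool
      imageSide i = [ inA C , const false ]′ (image i)

      imageSide-inj₁ : ∀ {i a} → image i ≡ inj₁ a → imageSide i ≡ inA C a
      imageSide-inj₁ = cong [ inA C , const false ]′

      -- For i kept in V(C) by σ and j moved out, adj i j = adj (σ i) (σ j) = inA C (σ i): the kept
      -- vertices are joined to the others along the sides of their images.
      partialImage⇒decomposable : Nonempty (leftPart image) → Nonempty (∁ (leftPart image)) →
                                  Decomposable (graph C)
      partialImage⇒decomposable =
        decomposable-along (graph C) (leftPart image) imageSide side-clique side-indep side-join
        where
        side-clique : ∀ i j → i ≢ j → i ∈ leftPart image → j ∈ leftPart image →
                      imageSide i ≡ true → imageSide j ≡ true → adj (graph C) i j ≡ true
        side-clique i j i≢j i∈ j∈ si sj with ∈-leftPart⁻ image i∈ | ∈-leftPart⁻ image j∈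
        ... | a , ia | b , jb =
          trans (adj-image i j) (trans (cong₂ cadjG ia jb)
            (clique C a b (λ a≡b → i≢j (image-injective (trans ia (trans (cong inj₁ a≡b) (sym jb)))))
                          (trans (sym (imageSide-inj₁ ia)) si) (trans (sym (imageSide-inj₁ jb)) sj)))
        side-indep : ∀ i j → i ∈ leftPart image → j ∈ leftPart image →
                     imageSide i ≡ false → imageSide j ≡ false → adj (graph C) i j ≡ false
        side-indep i j i∈ j∈ si sj with ∈-leftPart⁻ image i∈ | ∈-leftPart⁻ image j∈
        ... | a , ia | b , jb =
          trans (adj-image i j) (trans (cong₂ cadjG ia jb)
            (indep C a b (trans (sym (imageSide-inj₁ ia)) si) (trans (sym (imageSide-inj₁ jb)) sj)))
        side-join : ∀ i j → i ∈ leftPart image → j ∉ leftPart image → adj (graph C) i j ≡ imageSide i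
        side-join i j i∈ j∉ with ∈-leftPart⁻ image i∈ | ∉-leftPart⁻ image j∉
        ... | a , ia | b , jb = trans (adj-image i j) (trans (cong₂ cadjG ia jb) (sym (imageSide-inj₁ ia)))

      emptyImage⇒preimage-↑ʳ : (∀ i → i ∉ leftPart image) → ∀ v → ∃ λ c → σ ⟨$⟩ˡ (v ↑ˡ l) ≡ k ↑ʳ c
      emptyImage⇒preimage-↑ʳ empty v with σ ⟨$⟩ˡ (v ↑ˡ l) | inverseʳ σ {v ↑ˡ l}
      ... | x | σx≡v with block k x
      ...   | right c = c , refl
      ...   | left w  = ⊥-elim (empty w (∈-leftPart⁺ image (trans (cong (splitAt k) σx≡v) (splitAt-↑ˡ k v l))))

      -- σ u ∈ V(H) sees v ∈ V(C) according to inA C v, while u sees σ⁻¹ v ∈ V(H) according to inA C u.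
      emptyImage⇒constantPartition : (∀ i → i ∉ leftPart image) → ∀ u v → inA C v ≡ inA C u
      emptyImage⇒constantPartition empty u v
        with ∉-leftPart⁻ image (empty u) | emptyImage⇒preimage-↑ʳ empty v
      ... | b , ub | c , back = begin
        inA C v                                      ≡⟨ cong (λ x → cadjG x (inj₁ v)) (sym ub) ⟩
        cadjG (image u) (inj₁ v)                     ≡⟨ cong (cadjG (image u)) (sym (splitAt-↑ˡ k v l)) ⟩
        adj G (σ ⟨$⟩ʳ (u ↑ˡ l)) (v ↑ˡ l)             ≡⟨ cong (adj G _) (sym (inverseʳ σ)) ⟩
        adj G (σ ⟨$⟩ʳ (u ↑ˡ l)) (σ ⟨$⟩ʳ (σ ⟨$⟩ˡ (v ↑ˡ l))) ≡⟨ aut _ _ ⟩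
        adj G (u ↑ˡ l) (σ ⟨$⟩ˡ (v ↑ˡ l))             ≡⟨ cong (adj G _) back ⟩
        adj G (u ↑ˡ l) (k ↑ʳ c)                      ≡⟨ adj-↑ˡ-↑ʳ u c ⟩
        inA C u                                      ∎
        where open ≡-Reasoning

    indecomposable⇒leftInvariant : ∀ σ → IsAutomorphism G σ → LeftInvariant k σ
    indecomposable⇒leftInvariant σ aut i with image σ aut i in eq
    ... | inj₁ a = a , sym (splitAt⁻¹-↑ˡ eq)
    ... | inj₂ b with nonempty? (leftPart (image σ aut))
    ...   | yes someKept = ⊥-elim (indecomposable
            (partialImage⇒decomposable σ aut someKept (i , x∉p⇒x∈∁p (∉-leftPart⁺ (image σ aut) eq))))
    ...   | no noneKept = ⊥-elim (indecomposable (constantPartition⇒decomposable C two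
            (λ v → emptyImage⇒constantPartition σ aut (λ w w∈ → noneKept (w , w∈)) i v)))

    splitsAutomorphisms-indecomposable : SplitsAutomorphisms
    splitsAutomorphisms-indecomposable =
      indecomposable⇒leftInvariant ,
      λ ρ aut → ksPartition-unique (graph C) two indecomposable
                  (isKSPartition-automorphism (graph C) ρ aut (clique C , indep C)) (clique C , indep C)

runGraph-universal : (t : Bool) (m : ℕ) (i : Fin m) → Universal (runGraph t m) t i
runGraph-universal t m i w w≢i = trans (cong (t ∧_) (neq-true i w (w≢i ∘ sym))) (∧-identityʳ t)

runGraph-noUniversal : {m : ℕ} → 2 ≤ m → NoUniversal (runGraph t m) (not t)
runGraph-noUniversal {m = m} two x u = not-¬ (runGraph-universal _ _ x w w≢x) (u w w≢x)
  where
  w : Fin m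
  w = proj₁ (another two x)
  w≢x : w ≢ x
  w≢x = proj₂ (another two x)

module _ (t : Bool) (m : ℕ) (H : Graph) where

  private
    l : ℕ
    l = n H
    G : Graph
    G = runComp t m ∘ₛ H

  run-universal : ∀ i → Universal G t (i ↑ˡ l)
  run-universal i w w≢i↑ˡ with block m w
  ... | left j  = trans (adj-↑ˡ-↑ˡ (runComp t m) H i j) (runGraph-universal t m i j (w≢i↑ˡ ∘ cong (_↑ˡ l)))
  ... | right j = adj-↑ˡ-↑ʳ (runComp t m) H i j

  splitsAutomorphisms-run : NoUniversal H t → SplitsAutomorphisms (runComp t m) H
  splitsAutomorphisms-run noUniversal =
    universalBlock⇒leftInvariant (runComp t m) H run-universal
      (λ j u → noUniversal j (universal-↑ʳ (runComp t m) H u)) ,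
    λ _ _ _ → refl

  noUniversal-run∘ₛ : 1 ≤ m → 1 ≤ l → NoUniversal G (not t)
  noUniversal-run∘ₛ m≥1 l≥1 x u with block m x
  ... | left i  = not-¬ (adj-↑ˡ-↑ʳ (runComp t m) H i h) (u (m ↑ʳ h) (↑ˡ≢↑ʳ ∘ sym))
    where
    h : Fin l
    h = fromℕ< l≥1
  ... | right j = not-¬ (adj-↑ʳ-↑ˡ (runComp t m) H j d) (u (d ↑ˡ l) ↑ˡ≢↑ʳ)
    where
    d : Fin m
    d = fromℕ< m≥1

-- Fixing sets and fixing numbers along a decomposition

SplitsAutomorphismsAlong : List SplitGraph → Graph → Set
SplitsAutomorphismsAlong []       G0 = ⊤
SplitsAutomorphismsAlong (C ∷ Cs) G0 = SplitsAutomorphisms C (compose Cs G0) × SplitsAutomorphismsAlong Cs G0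

fixingSet⇔allFixing : ∀ Cs G0 → SplitsAutomorphismsAlong Cs G0 →
                      ∀ S → IsFixingSet (compose Cs G0) S ⇔ AllFixing Cs G0 S
fixingSet⇔allFixing []       G0 _                       S = ⇔-id _
fixingSet⇔allFixing (C ∷ Cs) G0 (splits , splitsAlong) S =
  (⇔-id _ ×-⇔ fixingSet⇔allFixing Cs G0 splitsAlong (drop (n (graph C)) S))
    ⇔-∘ fixingSet-∘ₛ C (compose Cs G0) splits S

MinimumSize : {m : ℕ} → (Subset m → Set) → ℕ → Set
MinimumSize {m} P k = (Σ (Subset m) λ S → P S × ∣ S ∣ ≡ k) × (∀ S → P S → k ≤ ∣ S ∣)

module _ {a b : ℕ} (P : Subset (a + b) → Set) (Q : Subset a → Set) (R : Subset b → Set)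
         (split : ∀ S → P S ⇔ (Q (take a S) × R (drop a S))) where

  private
    glue : ∀ {T U} → Q T → R U → P (T ++ U)
    glue {T} {U} QT RU =
      Equivalence.from (split (T ++ U)) (subst Q (sym (take-++ T U)) QT , subst R (sym (drop-++ T U)) RU)

  minimumSize-split⁻ : ∀ {k} → MinimumSize P k → ∃₂ λ k₁ k₂ → k ≡ k₁ + k₂ × MinimumSize Q k₁ × MinimumSize R k₂
  minimumSize-split⁻ {k} ((S , PS , ∣S∣≡k) , minimal) =
    ∣ take a S ∣ , ∣ drop a S ∣ , k≡ , ((take a S , QS , refl) , minimalˡ) , ((drop a S , RS , refl) , minimalʳ)
    where
    open ≤-Reasoning
    QS : Q (take a S)
    QS = proj₁ (Equivalence.to (split S) PS)
    RS : R (drop a S)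
    RS = proj₂ (Equivalence.to (split S) PS)
    k≡ : k ≡ ∣ take a S ∣ + ∣ drop a S ∣
    k≡ = trans (sym ∣S∣≡k) (∣p∣≡∣take∣+∣drop∣ a S)
    minimalˡ : ∀ T → Q T → ∣ take a S ∣ ≤ ∣ T ∣
    minimalˡ T QT = +-cancelʳ-≤ ∣ drop a S ∣ _ _ (begin
      ∣ take a S ∣ + ∣ drop a S ∣ ≡⟨ sym k≡ ⟩
      k                           ≤⟨ minimal _ (glue QT RS) ⟩
      ∣ T ++ drop a S ∣           ≡⟨ ∣p++q∣≡∣p∣+∣q∣ T (drop a S) ⟩
      ∣ T ∣ + ∣ drop a S ∣        ∎)
    minimalʳ : ∀ U → R U → ∣ drop a S ∣ ≤ ∣ U ∣
    minimalʳ U RU = +-cancelˡ-≤ ∣ take a S ∣ _ _ (begin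
      ∣ take a S ∣ + ∣ drop a S ∣ ≡⟨ sym k≡ ⟩
      k                           ≤⟨ minimal _ (glue QS RU) ⟩
      ∣ take a S ++ U ∣           ≡⟨ ∣p++q∣≡∣p∣+∣q∣ (take a S) U ⟩
      ∣ take a S ∣ + ∣ U ∣        ∎)

  minimumSize-split⁺ : ∀ {k} → (∃₂ λ k₁ k₂ → k ≡ k₁ + k₂ × MinimumSize Q k₁ × MinimumSize R k₂) →
                       MinimumSize P k
  minimumSize-split⁺ {k} (k₁ , k₂ , k≡ , ((T , QT , ∣T∣≡k₁) , minimalˡ) , ((U , RU , ∣U∣≡k₂) , minimalʳ)) =
    (T ++ U , glue QT RU , trans (∣p++q∣≡∣p∣+∣q∣ T U) (trans (cong₂ _+_ ∣T∣≡k₁ ∣U∣≡k₂) (sym k≡))) ,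
    λ S PS → begin
      k                           ≡⟨ k≡ ⟩
      k₁ + k₂                     ≤⟨ +-mono-≤ (minimalˡ _ (proj₁ (Equivalence.to (split S) PS)))
                                              (minimalʳ _ (proj₂ (Equivalence.to (split S) PS))) ⟩
      ∣ take a S ∣ + ∣ drop a S ∣ ≡⟨ sym (∣p∣≡∣take∣+∣drop∣ a S) ⟩
      ∣ S ∣                       ∎
    where open ≤-Reasoning

fixNumber⇔fixSum : ∀ Cs G0 → SplitsAutomorphismsAlong Cs G0 → ∀ k → FixNumber (compose Cs G0) k ⇔ FixSum Cs G0 k
fixNumber⇔fixSum []       G0 _                       k = ⇔-id _
fixNumber⇔fixSum (C ∷ Cs) G0 (splits , splitsAlong) k = mk⇔
  (λ fix → let (k₁ , k₂ , k≡ , fixC , fixH) = minimumSize-split⁻ P Q R split fix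
           in k₁ , k₂ , k≡ , fixC , Equivalence.to (ih k₂) fixH)
  (λ (k₁ , k₂ , k≡ , fixC , sum) →
     minimumSize-split⁺ P Q R split (k₁ , k₂ , k≡ , fixC , Equivalence.from (ih k₂) sum))
  where
  P : Subset (n (compose (C ∷ Cs) G0)) → Set
  P = IsFixingSet (compose (C ∷ Cs) G0)
  Q : Subset (n (graph C)) → Set
  Q = IsFixingSet (graph C)
  R : Subset (n (compose Cs G0)) → Set
  R = IsFixingSet (compose Cs G0)
  split : ∀ S → P S ⇔ (Q (take (n (graph C)) S) × R (drop (n (graph C)) S))
  split = fixingSet-∘ₛ C (compose Cs G0) splits
  ih : ∀ k → FixNumber (compose Cs G0) k ⇔ FixSum Cs G0 k
  ih = fixNumber⇔fixSum Cs G0 splitsAlong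

-- The compact canonical decomposition

PendingRun : Maybe (Bool × ℕ) → Set
PendingRun nothing        = ⊤
PendingRun (just (_ , m)) = 1 ≤ m

-- compactGo (just (t , m)) produces a decomposition beginning with a run of type t; a run of
-- the opposite type placed in front of it must still split automorphisms.
AfterRun : Maybe (Bool × ℕ) → Graph → Set
AfterRun nothing        G = ⊤
AfterRun (just (t , _)) G = NoUniversal G (not t)

CompactInvariant : Maybe (Bool × ℕ) → List SplitGraph × Graph → Set
CompactInvariant run (Cs , G0) =
  SplitsAutomorphismsAlong Cs G0 × 1 ≤ n (compose Cs G0) × AfterRun run (compose Cs G0)

single≡nothing⇒2≤ : ∀ m (f : Fin m → Bool) → single m f ≡ nothing → 1 ≤ m → 2 ≤ m
single≡nothing⇒2≤ (suc (suc m)) f _ _ = s≤s (s≤s z≤n)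

isOne≡false⇒2≤ : ∀ m → isOne m ≡ false → 1 ≤ m → 2 ≤ m
isOne≡false⇒2≤ (suc (suc m)) _ _ = s≤s (s≤s z≤n)

eqB≡true⇒≡ : ∀ t t' → eqB t t' ≡ true → t' ≡ t
eqB≡true⇒≡ true  true  _ = refl
eqB≡true⇒≡ false false _ = refl

eqB≡false⇒≡not : ∀ t t' → eqB t t' ≡ false → t' ≡ not t
eqB≡false⇒≡not true  false _ = refl
eqB≡false⇒≡not false true  _ = refl

1≤+ : ∀ {a} b → 1 ≤ a → 1 ≤ a + b
1≤+ b a≥1 = ≤-trans a≥1 (m≤m+n _ b)

prependRun : ∀ t m Cs G0 → 1 ≤ m → NoUniversal (compose Cs G0) t →
             CompactInvariant nothing (Cs , G0) → CompactInvariant (just (t , m)) (runComp t m ∷ Cs , G0)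
prependRun t m Cs G0 m≥1 noUniversal (splitsAlong , size , _) =
  (splitsAutomorphisms-run t m H noUniversal , splitsAlong) , 1≤+ (n H) m≥1 , noUniversal-run∘ₛ t m H m≥1 size
  where
  H : Graph
  H = compose Cs G0

prependIndecomposable : ∀ run C Cs G0 → PendingRun run → 2 ≤ n (graph C) → Indecomposable (graph C) →
                        CompactInvariant nothing (Cs , G0) →
                        CompactInvariant run (flush run List.++ C ∷ Cs , G0)
prependIndecomposable nothing C Cs G0 _ c≥2 indecomposable (splitsAlong , _ , _) =
  (splitsAutomorphisms-indecomposable C (compose Cs G0) c≥2 indecomposable , splitsAlong) ,
  1≤+ (n (compose Cs G0)) (≤-trans (s≤s z≤n) c≥2) , tt
prependIndecomposable (just (t , m)) C Cs G0 m≥1 c≥2 indecomposable invariant =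
  prependRun t m (C ∷ Cs) G0 m≥1 (noUniversal-indecomposable∘ₛ C (compose Cs G0) c≥2 indecomposable)
    (prependIndecomposable nothing C Cs G0 tt c≥2 indecomposable invariant)

compactGo-invariant : ∀ run Cs G0 → PendingRun run → IsCanonical Cs G0 →
                      CompactInvariant run (compactGo run Cs G0)
compactGo-invariant nothing [] G0 _ (_ , g≥1 , _) with isOne (n G0)
... | true  = tt , g≥1 , tt
... | false = tt , g≥1 , tt
compactGo-invariant (just (t , m)) [] G0 m≥1 (_ , g≥1 , g-indecomposable) with isOne (n G0) in one
... | true  = tt , s≤s z≤n , runGraph-noUniversal (s≤s m≥1)
... | false = prependRun t m [] G0 m≥1
                (indecomposable⇒noUniversal G0 (isOne≡false⇒2≤ _ one g≥1) g-indecomposable) (tt , g≥1 , tt)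
compactGo-invariant run (C ∷ Cs) G0 pending ((c≥1 , c-indecomposable) ∷ cs , g) with stype C in st | run
... | nothing | run' =
  prependIndecomposable run' C _ _ pending (single≡nothing⇒2≤ _ (inA C) st c≥1) c-indecomposable
    (compactGo-invariant nothing Cs G0 tt (cs , g))
... | just t | nothing with compactGo-invariant (just (t , 1)) Cs G0 (s≤s z≤n) (cs , g)
...   | splitsAlong , size , _ = splitsAlong , size , tt
compactGo-invariant run (C ∷ Cs) G0 pending ((c≥1 , c-indecomposable) ∷ cs , g) | just t | just (t' , m)
  with eqB t t' in same
...   | true with refl ← eqB≡true⇒≡ t t' same = compactGo-invariant (just (t , suc m)) Cs G0 (s≤s z≤n) (cs , g)
...   | false with refl ← eqB≡false⇒≡not t t' same
                 | splitsAlong , size , afterRun ← compactGo-invariant (just (t , 1)) Cs G0 (s≤s z≤n) (cs , g) =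
  prependRun (not t) m _ _ pending afterRun (splitsAlong , size , tt)

mainTheorem5 :
  (Cs : List SplitGraph) (G0 : Graph) → IsCanonical Cs G0 →
  ((S : Subset (n (compose (proj₁ (compact Cs G0)) (proj₂ (compact Cs G0))))) →
     IsFixingSet (compose (proj₁ (compact Cs G0)) (proj₂ (compact Cs G0))) S
     ⇔ AllFixing (proj₁ (compact Cs G0)) (proj₂ (compact Cs G0)) S)
  × ((k : ℕ) →
     FixNumber (compose (proj₁ (compact Cs G0)) (proj₂ (compact Cs G0))) k
     ⇔ FixSum (proj₁ (compact Cs G0)) (proj₂ (compact Cs G0)) k)
mainTheorem5 Cs G0 canonical =
  fixingSet⇔allFixing (proj₁ (compact Cs G0)) (proj₂ (compact Cs G0)) splitsAlong ,
  fixNumber⇔fixSum (proj₁ (compact Cs G0)) (proj₂ (compact Cs G0)) splitsAlong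
  where
  splitsAlong : SplitsAutomorphismsAlong (proj₁ (compact Cs G0)) (proj₂ (compact Cs G0))
  splitsAlong = proj₁ (compactGo-invariant nothing Cs G0 tt canonical)
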